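{- Let $n\ge1$ and $\sigma\in\mathfrak{D}_{n+1}$. Let $\varphi(\sigma)$ be the grid with $n$ columns and $2n$ rows whose $j$-th column, for each $j\in[n]$, contains exactly the two dots labelled $\sigma^{ -1}(2j)$ and $\sigma^{ -1}(2j+1)$ (each dot being placed in the row carrying that label). Then $\varphi(\sigma)$ is a Dellac configuration of size $n$.
   Context: Row labels: for $i\in[n]$, row $i$ (rows indexed $1..2n$ from bottom to top) carries the label $e_i=2i+2$ and row $n+i$ carries the label $e_{n+i}=2i-1$; thus the labels are exactly $[2n+2]\setminus\{2,2n+1\}$. (For $\sigma\in\mathfrak{D}_{n+1}$ one has $\sigma(2)=1$ and $\sigma(2n+1)=2n+2$, so $\sigma^{ -1}(2j),\sigma^{ -1}(2j+1)$ are labels for $j\in[n]$.) A Dumont permutation of order $2m$ is $\sigma\in\mathfrak{S}_{2m}$ with $\sigma(2i)<2i$ and $\sigma(2i-1)>2i-1$ for all $i\in[m]$; $\mathfrak{D}_m$ is their set. A Dellac configuration of size $n$ is a placement of $2n$ dots in a grid with $n$ columns (indexed $1..n$ left to right) and $2n$ rows such that each row contains exactly one dot, each column exactly two dots, and each dot in column $j$, row $i$ satisfies $j\le i\le j+n$. -}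

module Defs where

open import Data.Nat using (ℕ; zero; suc; _+_; _*_; _∸_; _≤_; _<_; _<?_; _≡ᵇ_)
open import Data.Bool using (Bool; true; false; _∨_; if_then_else_)
open import Data.Fin using (Fin; toℕ; fromℕ<)
open import Data.Fin.Permutation using (Permutation′; _⟨$⟩ʳ_; _⟨$⟩ˡ_)
open import Data.Product using (_×_)
open import Relation.Binary.PropositionalEquality using (_≡_)
open import Relation.Nullary using (yes; no)

-- Extend a function on Fin N (0-based) to a 1-based function on ℕ:
-- k ∈ [1..N] is sent to 1 + toℕ (f (k-1)); values outside [1..N] are sent to 0.
oneBased : ∀ {N} → (Fin N → Fin N) → ℕ → ℕ
oneBased {N} f zero = zero
oneBased {N} f (suc k) with k <? N
... | yes k<N = suc (toℕ (f (fromℕ< k<N)))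
... | no _ = zero

app : ∀ {N} → Permutation′ N → ℕ → ℕ
app σ = oneBased (σ ⟨$⟩ʳ_)

appInv : ∀ {N} → Permutation′ N → ℕ → ℕ
appInv σ = oneBased (σ ⟨$⟩ˡ_)

IsDumont : (m : ℕ) → Permutation′ (2 * m) → Set
IsDumont m σ = ∀ (i : ℕ) → 1 ≤ i → i ≤ m →
  (app σ (2 * i) < 2 * i) × (2 * i ∸ 1 < app σ (2 * i ∸ 1))

-- A grid with n columns and 2n rows: dot (row r, column c), 0-based Fin indices
-- (row r corresponds to row toℕ r + 1 counted from the bottom, column c to column toℕ c + 1).
Grid : ℕ → Set
Grid n = Fin (2 * n) → Fin n → Bool

countTrue : ∀ {k} → (Fin k → Bool) → ℕ
countTrue {zero} f = zero
countTrue {suc k} f = (if f Fin.zero then 1 else 0) + countTrue (λ x → f (Fin.suc x))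

IsDellac : (n : ℕ) → Grid n → Set
IsDellac n g =
  (∀ (r : Fin (2 * n)) → countTrue (λ c → g r c) ≡ 1) ×
  (∀ (c : Fin n) → countTrue (λ r → g r c) ≡ 2) ×
  (∀ (r : Fin (2 * n)) (c : Fin n) → g r c ≡ true →
     (suc (toℕ c) ≤ suc (toℕ r)) × (suc (toℕ r) ≤ suc (toℕ c) + n))

-- Row labels (1-based row index i ∈ [2n]): e_i = 2i+2 for i ≤ n, e_{n+i} = 2i-1.
rowLabel : ℕ → ℕ → ℕ
rowLabel n i with n <? i
... | yes _ = 2 * (i ∸ n) ∸ 1
... | no _ = 2 * i + 2

phi : (n : ℕ) → Permutation′ (2 * suc n) → Grid n
phi n σ r c =
  (rowLabel n i ≡ᵇ appInv σ (2 * j)) ∨ (rowLabel n i ≡ᵇ appInv σ (2 * j + 1))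
  where
  i = suc (toℕ r)
  j = suc (toℕ c)

-- The Dumont inequalities at 2 and 2n+1 force σ(2) = 1 and
-- σ(2n+1) = 2n+2.  The row labels are a bijection from the 2n rows onto
-- [1, 2n+2] ∖ {2, 2n+1}, so the "values" σ(e_r) of the rows run bijectively over
-- the inner values 2, …, 2n+1.  By definition φ(σ) has a dot in row r and column j
-- iff the value of r is 2j or 2j+1 (it lies in the pair of column j).  Hence:
--   * each row has one dot, since every inner value lies in exactly one pair;
--   * each column j has two dots, the rows with values 2j and 2j+1;
--   * a dot in row i, column j satisfies j ≤ i ≤ j+n, by the Dumont inequality
--     at the label of row i (even labels 2i+2 for i ≤ n, odd labels for i > n).
module Submission where

open import Defs
open import Data.Nat using (ℕ; zero; suc; _+_; _*_; _∸_; _≤_; _<_; _<?_; z≤n; s≤s)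
open import Data.Nat.Properties
open import Data.Fin using (Fin; toℕ; fromℕ<) renaming (zero to fzero; suc to fsuc)
open import Data.Fin.Properties using (toℕ<n; toℕ-injective; toℕ-fromℕ<; fromℕ<-toℕ) renaming (suc-injective to fsuc-injective)
open import Data.Fin.Permutation using (Permutation′; _⟨$⟩ʳ_; _⟨$⟩ˡ_; inverseˡ; inverseʳ)
open import Data.Bool using (Bool; true; false)
open import Data.Bool.Properties using (T-≡; T-∨)
open import Function using (_∘_; _⇔_; mk⇔; Equivalence)
open import Data.Product using (Σ; _×_; _,_; proj₁; proj₂)
open import Data.Sum using (_⊎_; inj₁; inj₂; [_,_]) renaming (map to ⊎-map)
open import Relation.Binary.PropositionalEquality using (_≡_; _≢_; ≢-sym; refl; sym; trans; cong; subst; module ≡-Reasoning)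
open import Relation.Nullary using (yes; no; ¬_; contradiction)

countTrue-none : ∀ {k} (f : Fin k → Bool) → (∀ x → f x ≡ false) → countTrue f ≡ 0
countTrue-none {zero}  f none = refl
countTrue-none {suc k} f none rewrite none fzero =
  countTrue-none (λ x → f (fsuc x)) (λ x → none (fsuc x))

not-true : ∀ {b} → ¬ (b ≡ true) → b ≡ false
not-true {false} _      = refl
not-true {true}  b≢true = contradiction refl b≢true

countTrue-single : ∀ {k} (f : Fin k → Bool) (x : Fin k) → f x ≡ true →
                   (∀ y → f y ≡ true → y ≡ x) → countTrue f ≡ 1
countTrue-single f fzero fx only rewrite fx =
  cong suc (countTrue-none _ λ y → not-true λ fy → suc≢zero (only (fsuc y) fy))
  where
  suc≢zero : ∀ {k} {y : Fin k} → ¬ (fsuc y ≡ fzero)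
  suc≢zero ()
countTrue-single f (fsuc x) fx only with f fzero in f0
... | true  = contradiction (only fzero f0) λ ()
... | false = countTrue-single (λ y → f (fsuc y)) x fx
                (λ y fy → fsuc-injective (only (fsuc y) fy))

countTrue-pair : ∀ {k} (f : Fin k → Bool) (x y : Fin k) → ¬ (x ≡ y) →
                 f x ≡ true → f y ≡ true →
                 (∀ z → f z ≡ true → z ≡ x ⊎ z ≡ y) → countTrue f ≡ 2
countTrue-pair f fzero fzero x≢y _ _ _ = contradiction refl x≢y
countTrue-pair f fzero (fsuc y) _ fx fy only rewrite fx =
  cong suc (countTrue-single _ y fy λ z fz → tail (only (fsuc z) fz))
  where
  tail : ∀ {z} → fsuc z ≡ fzero ⊎ fsuc z ≡ fsuc y → z ≡ y
  tail (inj₂ e) = fsuc-injective e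
countTrue-pair f (fsuc x) fzero _ fx fy only rewrite fy =
  cong suc (countTrue-single _ x fx λ z fz → tail (only (fsuc z) fz))
  where
  tail : ∀ {z} → fsuc z ≡ fsuc x ⊎ fsuc z ≡ fzero → z ≡ x
  tail (inj₁ e) = fsuc-injective e
countTrue-pair f (fsuc x) (fsuc y) x≢y fx fy only with f fzero in f0
... | true  = [ (λ ()) , (λ ()) ] (only fzero f0)
... | false = countTrue-pair (λ z → f (fsuc z)) x y (λ e → x≢y (cong fsuc e)) fx fy
                (λ z fz → ⊎-map fsuc-injective fsuc-injective (only (fsuc z) fz))

InPair : ℕ → ℕ → Set
InPair m j = m ≡ 2 * j ⊎ m ≡ suc (2 * j)

2*suc : ∀ x → 2 * suc x ≡ suc (suc (2 * x))
2*suc x = cong suc (+-suc x (x + 0))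

2*suc∸1 : ∀ x → 2 * suc x ∸ 1 ≡ suc (2 * x)
2*suc∸1 x = +-suc x (x + 0)

inPair-exists : ∀ m → Σ ℕ (InPair m)
inPair-exists zero = 0 , inj₁ refl
inPair-exists (suc m) with inPair-exists m
... | j , inj₁ m≡2j  = j , inj₂ (cong suc m≡2j)
... | j , inj₂ m≡2j+1 = suc j , inj₁ (trans (cong suc m≡2j+1) (sym (2*suc j)))

inPair-unique : ∀ {m j j′} → InPair m j → InPair m j′ → j ≡ j′
inPair-unique {j = j} {j′} (inj₁ e) (inj₁ e′) = *-cancelˡ-≡ j j′ 2 (trans (sym e) e′)
inPair-unique {j = j} {j′} (inj₂ e) (inj₂ e′) = *-cancelˡ-≡ j j′ 2 (suc-injective (trans (sym e) e′))
inPair-unique {j = j} {j′} (inj₁ e) (inj₂ e′) = contradiction (trans (sym e) e′) (even≢odd j j′)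
inPair-unique {j = j} {j′} (inj₂ e) (inj₁ e′) = contradiction (trans (sym e′) e) (even≢odd j′ j)

inPair-lower : ∀ {m j} → InPair m j → 2 * j ≤ m
inPair-lower (inj₁ e) = ≤-reflexive (sym e)
inPair-lower (inj₂ e) = ≤-trans (n≤1+n _) (≤-reflexive (sym e))

inPair-upper : ∀ {m j} → InPair m j → m ≤ suc (2 * j)
inPair-upper (inj₁ e) = ≤-trans (≤-reflexive e) (n≤1+n _)
inPair-upper (inj₂ e) = ≤-reflexive e

-- The inner values 2, …, 2n+1: everything in [1, 2n+2] except σ(2) = 1 and σ(2n+1) = 2n+2.
Inner : ℕ → ℕ → Set
Inner n k = 2 ≤ k × k ≤ suc (2 * n)

column-of : ∀ n m → Inner n m → Σ (Fin n) λ c → InPair m (suc (toℕ c))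
column-of n m (2≤m , m≤2n+1) with inPair-exists m
... | zero , p = contradiction (≤-trans 2≤m (inPair-upper {m} {0} p)) λ { (s≤s ()) }
... | suc j , p = fromℕ< j<n , subst (λ x → InPair m (suc x)) (sym (toℕ-fromℕ< j<n)) p
  where
  j<n : j < n
  j<n = *-cancelˡ-< 2 j n (≤-pred (≤-trans (≤-reflexive (sym (2*suc j)))
                                  (≤-trans (inPair-lower {m} {suc j} p) m≤2n+1)))

column-pair : ∀ n (c : Fin n) → let j = suc (toℕ c) in Inner n (2 * j) × Inner n (suc (2 * j))
column-pair n c = (*-monoʳ-≤ 2 (s≤s z≤n) , ≤-trans (*-monoʳ-≤ 2 (toℕ<n c)) (n≤1+n _)) ,
                  (≤-trans (*-monoʳ-≤ 2 (s≤s z≤n)) (n≤1+n _) , s≤s (*-monoʳ-≤ 2 (toℕ<n c)))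

module OneBased {N : ℕ} (σ : Permutation′ N) where

  InRange : ℕ → Set
  InRange k = 1 ≤ k × k ≤ N

  oneBased-suc : (f : Fin N → Fin N) {k : ℕ} (k<N : k < N) →
                 oneBased f (suc k) ≡ suc (toℕ (f (fromℕ< k<N)))
  oneBased-suc f {k} k<N with k <? N
  ... | yes _   = refl
  ... | no  k≮N = contradiction k<N k≮N

  oneBased-range : (f : Fin N → Fin N) → ∀ k → InRange k → InRange (oneBased f k)
  oneBased-range f (suc k) (_ , k<N) rewrite oneBased-suc f k<N = s≤s z≤n , toℕ<n _

  oneBased-inverse : (f g : Fin N → Fin N) → (∀ x → g (f x) ≡ x) →
                     ∀ k → InRange k → oneBased g (oneBased f k) ≡ k
  oneBased-inverse f g g∘f (suc k) (_ , k<N)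
    rewrite oneBased-suc f k<N
          | oneBased-suc g (toℕ<n (f (fromℕ< k<N)))
          | fromℕ<-toℕ (f (fromℕ< k<N)) (toℕ<n (f (fromℕ< k<N)))
          | g∘f (fromℕ< k<N)
          | toℕ-fromℕ< k<N = refl

  app-range : ∀ k → InRange k → InRange (app σ k)
  app-range = oneBased-range (σ ⟨$⟩ʳ_)

  appInv-range : ∀ k → InRange k → InRange (appInv σ k)
  appInv-range = oneBased-range (σ ⟨$⟩ˡ_)

  appInv-app : ∀ k → InRange k → appInv σ (app σ k) ≡ k
  appInv-app = oneBased-inverse (σ ⟨$⟩ʳ_) (σ ⟨$⟩ˡ_) (λ _ → inverseˡ σ)

  app-appInv : ∀ k → InRange k → app σ (appInv σ k) ≡ k
  app-appInv = oneBased-inverse (σ ⟨$⟩ˡ_) (σ ⟨$⟩ʳ_) (λ _ → inverseʳ σ)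

  app-injective : ∀ {k l} → InRange k → InRange l → app σ k ≡ app σ l → k ≡ l
  app-injective {k} {l} k∈ l∈ e =
    trans (sym (appInv-app k k∈)) (trans (cong (appInv σ) e) (appInv-app l l∈))

-- A Dumont permutation of order 2(m+1) fixes the ends of its range:
-- σ(2) < 2 forces σ(2) = 1, and σ(2m+1) > 2m+1 forces σ(2m+1) = 2m+2.
module DumontEnds {m : ℕ} {σ : Permutation′ (2 * suc m)} (dumont : IsDumont (suc m) σ) where
  open OneBased σ

  σ[2]≡1 : app σ 2 ≡ 1
  σ[2]≡1 = ≤-antisym (≤-pred (proj₁ (dumont 1 ≤-refl (s≤s z≤n))))
                     (proj₁ (app-range 2 (s≤s z≤n , *-monoʳ-≤ 2 (s≤s z≤n))))

  σ[2m+1]≡2m+2 : app σ (suc (2 * m)) ≡ 2 * suc m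
  σ[2m+1]≡2m+2 = ≤-antisym (proj₂ (app-range (suc (2 * m)) top∈))
                           (subst (_≤ app σ (suc (2 * m))) (sym (2*suc m)) σ[2m+1]>2m+1)
    where
    σ[2m+1]>2m+1 : suc (2 * m) < app σ (suc (2 * m))
    σ[2m+1]>2m+1 = subst (λ k → k < app σ k) (2*suc∸1 m)
                         (proj₂ (dumont (suc m) (s≤s z≤n) ≤-refl))
    top∈ : InRange (suc (2 * m))
    top∈ = s≤s z≤n , ≤-trans (n≤1+n _) (≤-reflexive (sym (2*suc m)))

rowLabel-lower : ∀ {n i} → i ≤ n → rowLabel n i ≡ 2 * suc i
rowLabel-lower {n} {i} i≤n with n <? i
... | yes n<i = contradiction i≤n (<⇒≱ n<i)
... | no  _   = trans (+-comm (2 * i) 2) (sym (2*suc i))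

rowLabel-upper : ∀ n a → rowLabel n (suc (n + a)) ≡ suc (2 * a)
rowLabel-upper n a with n <? suc (n + a)
... | no  n≮i = contradiction (s≤s (m≤m+n n a)) n≮i
... | yes _   = begin
  2 * (suc (n + a) ∸ n) ∸ 1 ≡⟨ cong (λ x → 2 * x ∸ 1) (+-∸-assoc 1 (m≤m+n n a)) ⟩
  2 * suc (n + a ∸ n) ∸ 1   ≡⟨ cong (λ x → 2 * suc x ∸ 1) (m+n∸m≡n n a) ⟩
  2 * suc a ∸ 1             ≡⟨ 2*suc∸1 a ⟩
  suc (2 * a)               ∎
  where open ≡-Reasoning

n+a<2n : ∀ {n a} → a < n → n + a < 2 * n
n+a<2n {n} {a} a<n = subst (n + a <_) (cong (n +_) (sym (+-identityʳ n))) (+-monoʳ-< n a<n)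

module RowLabels (n : ℕ) where

  label : Fin (2 * n) → ℕ
  label r = rowLabel n (suc (toℕ r))

  data RowShape (r : Fin (2 * n)) : Set where
    lower : ∀ b → toℕ r ≡ b → b < n → label r ≡ 2 * suc (suc b) → RowShape r
    upper : ∀ a → toℕ r ≡ n + a → a < n → label r ≡ suc (2 * a) → RowShape r

  rowShape : ∀ r → RowShape r
  rowShape r with n <? suc (toℕ r)
  ... | no  i≯n = lower (toℕ r) refl (≮⇒≥ i≯n) (rowLabel-lower (≮⇒≥ i≯n))
  ... | yes n<i = upper a r≡n+a a<n
                    (trans (cong (λ t → rowLabel n (suc t)) r≡n+a) (rowLabel-upper n a))
    where
    a = toℕ r ∸ n
    r≡n+a : toℕ r ≡ n + a
    r≡n+a = sym (m+[n∸m]≡n (≤-pred n<i))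
    a<n : a < n
    a<n = +-cancelˡ-< n a n (subst (_< n + n) r≡n+a
            (subst (toℕ r <_) (cong (n +_) (+-identityʳ n)) (toℕ<n r)))

  label-range : ∀ r → 1 ≤ label r × label r ≤ 2 * suc n
  label-range r with rowShape r
  ... | lower b _ b<n e = ≤-trans (s≤s z≤n) (≤-reflexive (sym e)) ,
                          ≤-trans (≤-reflexive e) (*-monoʳ-≤ 2 (s≤s b<n))
  ... | upper a _ a<n e = ≤-trans (s≤s z≤n) (≤-reflexive (sym e)) ,
                          ≤-trans (≤-reflexive e) (*-monoʳ-< 2 (s≤s (<⇒≤ a<n)))

  label≢2 : ∀ r → label r ≢ 2
  label≢2 r e with rowShape r
  ... | lower b _ _ e′ = contradiction (*-cancelˡ-≡ (suc (suc b)) 1 2 (trans (sym e′) e)) λ ()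
  ... | upper a _ _ e′ = even≢odd 1 a (trans (sym e) e′)

  label≢2n+1 : ∀ r → label r ≢ suc (2 * n)
  label≢2n+1 r e with rowShape r
  ... | lower b _ _ e′ = even≢odd (suc (suc b)) n (trans (sym e′) e)
  ... | upper a _ a<n e′ = <-irrefl (*-cancelˡ-≡ a n 2 (suc-injective (trans (sym e′) e))) a<n

  label-injective : ∀ {r r′} → label r ≡ label r′ → r ≡ r′
  label-injective {r} {r′} e with rowShape r | rowShape r′
  ... | lower b r≡b _ e₁ | lower b′ r′≡b′ _ e₂ = toℕ-injective (begin
    toℕ r ≡⟨ r≡b ⟩
    b     ≡⟨ suc-injective (suc-injective
               (*-cancelˡ-≡ (suc (suc b)) (suc (suc b′)) 2 (trans (sym e₁) (trans e e₂)))) ⟩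
    b′    ≡⟨ sym r′≡b′ ⟩
    toℕ r′ ∎)
    where open ≡-Reasoning
  ... | upper a r≡n+a _ e₁ | upper a′ r′≡n+a′ _ e₂ = toℕ-injective (begin
    toℕ r  ≡⟨ r≡n+a ⟩
    n + a  ≡⟨ cong (n +_) (*-cancelˡ-≡ a a′ 2 (suc-injective (trans (sym e₁) (trans e e₂)))) ⟩
    n + a′ ≡⟨ sym r′≡n+a′ ⟩
    toℕ r′ ∎)
    where open ≡-Reasoning
  ... | lower b _ _ e₁ | upper a′ _ _ e₂ =
    contradiction (trans (sym e₁) (trans e e₂)) (even≢odd (suc (suc b)) a′)
  ... | upper a _ _ e₁ | lower b′ _ _ e₂ =
    contradiction (trans (sym e₂) (trans (sym e) e₁)) (even≢odd (suc (suc b′)) a)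

  label-onto : ∀ ℓ → 1 ≤ ℓ → ℓ ≤ 2 * suc n → ℓ ≢ 2 → ℓ ≢ suc (2 * n) →
               Σ (Fin (2 * n)) λ r → label r ≡ ℓ
  label-onto ℓ 1≤ℓ ℓ≤2n+2 ℓ≢2 ℓ≢2n+1 with inPair-exists ℓ
  ... | zero , inj₁ ℓ≡0 = contradiction (≤-trans 1≤ℓ (≤-reflexive ℓ≡0)) λ ()
  ... | suc zero , inj₁ ℓ≡2 = contradiction ℓ≡2 ℓ≢2
  ... | suc (suc b) , inj₁ ℓ≡2b+4 = r , (begin
    label r                ≡⟨ cong (λ t → rowLabel n (suc t)) (toℕ-fromℕ< b<2n) ⟩
    rowLabel n (suc b)     ≡⟨ rowLabel-lower b<n ⟩
    2 * suc (suc b)        ≡⟨ sym ℓ≡2b+4 ⟩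
    ℓ                      ∎)
    where
    open ≡-Reasoning
    b<n : b < n
    b<n = ≤-pred (*-cancelˡ-≤ 2 (subst (_≤ 2 * suc n) ℓ≡2b+4 ℓ≤2n+2))
    b<2n : b < 2 * n
    b<2n = ≤-trans b<n (m≤m+n n (n + 0))
    r = fromℕ< b<2n
  ... | a , inj₂ ℓ≡2a+1 = r , (begin
    label r                ≡⟨ cong (λ t → rowLabel n (suc t)) (toℕ-fromℕ< (n+a<2n a<n)) ⟩
    rowLabel n (suc (n + a)) ≡⟨ rowLabel-upper n a ⟩
    suc (2 * a)            ≡⟨ sym ℓ≡2a+1 ⟩
    ℓ                      ∎)
    where
    open ≡-Reasoning
    a≤n : a ≤ n
    a≤n = ≤-pred (*-cancelˡ-< 2 a (suc n) (subst (_≤ 2 * suc n) ℓ≡2a+1 ℓ≤2n+2))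
    a<n : a < n
    a<n = ≤∧≢⇒< a≤n λ a≡n → ℓ≢2n+1 (trans ℓ≡2a+1 (cong (λ x → suc (2 * x)) a≡n))
    r = fromℕ< (n+a<2n a<n)

module PhiOfDumont (n : ℕ) (σ : Permutation′ (2 * suc n)) (dumont : IsDumont (suc n) σ) where
  open OneBased σ
  open DumontEnds {n} {σ} dumont
  open RowLabels n
  open Equivalence using (to; from)

  inner⇒inRange : ∀ {k} → Inner n k → InRange k
  inner⇒inRange (2≤k , k≤2n+1) =
    ≤-trans (n≤1+n 1) 2≤k , ≤-trans k≤2n+1 (≤-trans (n≤1+n _) (≤-reflexive (sym (2*suc n))))

  2∈ : InRange 2
  2∈ = s≤s z≤n , *-monoʳ-≤ 2 (s≤s z≤n)

  2n+1∈ : InRange (suc (2 * n))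
  2n+1∈ = s≤s z≤n , ≤-trans (n≤1+n _) (≤-reflexive (sym (2*suc n)))

  value : Fin (2 * n) → ℕ
  value r = app σ (label r)

  -- The labels avoid 2 and 2n+1, so by injectivity of σ the values avoid
  -- σ(2) = 1 and σ(2n+1) = 2n+2.
  value-inner : ∀ r → Inner n (value r)
  value-inner r = ≤∧≢⇒< 1≤v (≢-sym v≢1) ,
                  ≤-pred (subst (value r <_) (2*suc n) (≤∧≢⇒< v≤2n+2 v≢2n+2))
    where
    r∈ = label-range r
    1≤v = proj₁ (app-range (label r) r∈)
    v≤2n+2 = proj₂ (app-range (label r) r∈)
    v≢1 : value r ≢ 1
    v≢1 e = label≢2 r (app-injective r∈ 2∈ (trans e (sym σ[2]≡1)))
    v≢2n+2 : value r ≢ 2 * suc n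
    v≢2n+2 e = label≢2n+1 r (app-injective r∈ 2n+1∈ (trans e (sym σ[2m+1]≡2m+2)))

  value-injective : ∀ {r r′} → value r ≡ value r′ → r ≡ r′
  value-injective {r} {r′} e = label-injective (app-injective (label-range r) (label-range r′) e)

  -- Every inner value is the value of some row: its preimage under σ is a label.
  row-of-value : ∀ k → Inner n k → Σ (Fin (2 * n)) λ r → value r ≡ k
  row-of-value k k∈@(2≤k , k≤2n+1) with label-onto ℓ (proj₁ ℓ∈) (proj₂ ℓ∈) ℓ≢2 ℓ≢2n+1
    where
    ℓ = appInv σ k
    ℓ∈ = appInv-range k (inner⇒inRange k∈)
    σℓ≡k = app-appInv k (inner⇒inRange k∈)
    ℓ≢2 : ℓ ≢ 2
    ℓ≢2 e = contradiction (≤-trans 2≤k (≤-reflexive k≡1)) λ { (s≤s ()) }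
      where
      k≡1 : k ≡ 1
      k≡1 = trans (sym σℓ≡k) (trans (cong (app σ) e) σ[2]≡1)
    ℓ≢2n+1 : ℓ ≢ suc (2 * n)
    ℓ≢2n+1 e = 1+n≰n (≤-trans (≤-reflexive (trans (sym (2*suc n)) (sym k≡2n+2))) k≤2n+1)
      where
      k≡2n+2 : k ≡ 2 * suc n
      k≡2n+2 = trans (sym σℓ≡k) (trans (cong (app σ) e) σ[2m+1]≡2m+2)
  ... | r , e = r , trans (cong (app σ) e) (app-appInv k (inner⇒inRange k∈))

  label≡preimage⇔ : ∀ r k → Inner n k → (label r ≡ appInv σ k) ⇔ (value r ≡ k)
  label≡preimage⇔ r k k∈ = mk⇔
    (λ e → trans (cong (app σ) e) (app-appInv k (inner⇒inRange k∈)))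
    (λ e → trans (sym (appInv-app (label r) (label-range r))) (cong (appInv σ) e))

  phi⇔inPair : ∀ r c → (phi n σ r c ≡ true) ⇔ InPair (value r) (suc (toℕ c))
  phi⇔inPair r c =
    mk⇔ (λ e → ⊎-map (to at-even ∘ ≡ᵇ⇒≡ _ _) (to at-odd ∘ ≡ᵇ⇒≡ _ _) (to T-∨ (from T-≡ e)))
        (λ p → to T-≡ (from T-∨ (⊎-map (≡⇒≡ᵇ _ _ ∘ from at-even) (≡⇒≡ᵇ _ _ ∘ from at-odd) p)))
    where
    j = suc (toℕ c)
    at-even : (label r ≡ appInv σ (2 * j)) ⇔ (value r ≡ 2 * j)
    at-even = label≡preimage⇔ r (2 * j) (proj₁ (column-pair n c))
    at-odd : (label r ≡ appInv σ (2 * j + 1)) ⇔ (value r ≡ suc (2 * j))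
    at-odd = subst (λ k → (label r ≡ appInv σ k) ⇔ (value r ≡ suc (2 * j))) (+-comm 1 (2 * j))
                   (label≡preimage⇔ r (suc (2 * j)) (proj₂ (column-pair n c)))

  -- Each row has exactly one dot: its value lies in the pair of exactly one column.
  row-count : ∀ r → countTrue (λ c → phi n σ r c) ≡ 1
  row-count r with column-of n (value r) (value-inner r)
  ... | c , p = countTrue-single _ c (from (phi⇔inPair r c) p)
                  λ c′ e → toℕ-injective (suc-injective
                             (inPair-unique (to (phi⇔inPair r c′) e) p))

  -- Each column j has exactly two dots: the rows whose values are 2j and 2j+1.
  column-count : ∀ c → countTrue (λ r → phi n σ r c) ≡ 2
  column-count c with row-of-value (2 * j) (proj₁ (column-pair n c))
                    | row-of-value (suc (2 * j)) (proj₂ (column-pair n c))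
    where j = suc (toℕ c)
  ... | r₁ , v₁ | r₂ , v₂ =
    countTrue-pair _ r₁ r₂ r₁≢r₂
      (from (phi⇔inPair r₁ c) (inj₁ v₁))
      (from (phi⇔inPair r₂ c) (inj₂ v₂))
      λ r e → ⊎-map (λ v → value-injective (trans v (sym v₁)))
                    (λ v → value-injective (trans v (sym v₂)))
                    (to (phi⇔inPair r c) e)
    where
    j = suc (toℕ c)
    r₁≢r₂ : r₁ ≢ r₂
    r₁≢r₂ e = even≢odd j j (trans (sym v₁) (trans (cong value e) v₂))

  -- For a lower row the label
  -- 2(i+1) is an even position, so 2j ≤ σ(2(i+1)) < 2(i+1); for an upper row
  -- i = n+a+1 the label 2a+1 is odd, so 2a+1 < σ(2a+1) ≤ 2j+1.  The two remaining
  -- inequalities hold for every row and column.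
  dot-position : ∀ r c → phi n σ r c ≡ true →
                 (suc (toℕ c) ≤ suc (toℕ r)) × (suc (toℕ r) ≤ suc (toℕ c) + n)
  dot-position r c e with rowShape r | to (phi⇔inPair r c) e
  ... | lower b r≡b b<n lab | p =
    subst (j ≤_) (cong suc (sym r≡b)) (≤-pred (*-cancelˡ-< 2 j (suc (suc b)) 2j<2i+2)) ,
    subst (_≤ j + n) (cong suc (sym r≡b)) (≤-trans b<n (m≤n+m n j))
    where
    j = suc (toℕ c)
    σ[2i+2]<2i+2 : app σ (2 * suc (suc b)) < 2 * suc (suc b)
    σ[2i+2]<2i+2 = proj₁ (dumont (suc (suc b)) (s≤s z≤n) (s≤s b<n))
    2j<2i+2 : 2 * j < 2 * suc (suc b)
    2j<2i+2 = ≤-<-trans (inPair-lower {j = j} p)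
                        (subst (λ ℓ → app σ ℓ < 2 * suc (suc b)) (sym lab) σ[2i+2]<2i+2)
  ... | upper a r≡n+a a<n lab | p =
    subst (j ≤_) (cong suc (sym r≡n+a)) (≤-trans (toℕ<n c) (≤-trans (m≤m+n n a) (n≤1+n _))) ,
    subst (_≤ j + n) (cong suc (sym r≡n+a)) (≤-trans (≤-reflexive (sym (+-suc n a))) n+a+1≤j+n)
    where
    j = suc (toℕ c)
    σ[2a+1]>2a+1 : suc (2 * a) < app σ (suc (2 * a))
    σ[2a+1]>2a+1 = subst (λ k → k < app σ k) (2*suc∸1 a)
                         (proj₂ (dumont (suc a) (s≤s z≤n) (s≤s (<⇒≤ a<n))))
    2a+1<value : suc (2 * a) < value r
    2a+1<value = subst (λ ℓ → suc (2 * a) < app σ ℓ) (sym lab) σ[2a+1]>2a+1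
    a<j : a < j
    a<j = *-cancelˡ-< 2 a j (≤-pred (<-≤-trans 2a+1<value (inPair-upper {j = j} p)))
    n+a+1≤j+n : n + suc a ≤ j + n
    n+a+1≤j+n = subst (n + suc a ≤_) (+-comm n j) (+-monoʳ-≤ n a<j)

proposition3 : (n : ℕ) → 1 ≤ n → (σ : Permutation′ (2 * suc n)) →
    IsDumont (suc n) σ → IsDellac n (phi n σ)
proposition3 n _ σ dumont = row-count , column-count , dot-position
  where open PhiOfDumont n σ dumont
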